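{- For every positive integer $n$ and every $\pi\in\Pi(n)$, $|S^{M}_{\mathrm{out}}(\pi)| = |S^{M}_{\mathrm{in}}(\pi)| = 2^{n-1}$.
   Context: $\Pi(n)$ denotes the set of permutations of $\{1,\dots,n\}$, each regarded as a sequence $\pi=(\pi_1,\dots,\pi_n)$. A mirror TDRL (MTDRL) operation on $\pi$ is specified by a binary pattern $b\in\{0,1\}^n$. Its result is the concatenation of two subsequences: first $(\pi_i:b_i=1)$ with indices in increasing order, then $(\pi_i:b_i=0)$ with indices in decreasing order. Example: $\pi=(1,2,3,4,5)$ and $b=01101$ give $(2,3,5,4,1)$. $S^{M}_{\mathrm{out}}(\pi)$ is the set of all sequences obtainable from $\pi$ by one MTDRL operation. $S^{M}_{\mathrm{in}}(\pi)=\{\rho\in\Pi(n):\pi\in S^{M}_{\mathrm{out}}(\rho)\}$. -}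

module Defs where

open import Data.Nat using (ℕ; zero; suc; _≡ᵇ_)
open import Data.Bool using (Bool; true; false; _∧_; _∨_; T)
open import Data.List using (List; []; _∷_; _++_; reverse; length; map; upTo)
open import Data.Vec using (Vec; []; _∷_; toList)
open import Data.Product using (Σ; Σ-syntax; _,_)
open import Data.Fin using (Fin)
open import Function.Bundles using (_⤖_)

-- A sequence of length n is a vector of naturals; a binary pattern is a Vec Bool n
-- (true = 1, false = 0).

elemᵇ : ℕ → List ℕ → Bool
elemᵇ x []       = false
elemᵇ x (y ∷ ys) = (x ≡ᵇ y) ∨ elemᵇ x ys

distinctᵇ : List ℕ → Bool
distinctᵇ []       = true
distinctᵇ (x ∷ xs) = (Data.Bool.not (elemᵇ x xs)) ∧ distinctᵇ xs

allInᵇ : List ℕ → List ℕ → Bool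
allInᵇ []       ys = true
allInᵇ (x ∷ xs) ys = elemᵇ x ys ∧ allInᵇ xs ys

IsPermᵇ : {n : ℕ} → Vec ℕ n → Bool
IsPermᵇ {n} π = distinctᵇ (toList π) ∧ allInᵇ (toList π) (map suc (upTo n))

Perm : ℕ → Set
Perm n = Σ[ π ∈ Vec ℕ n ] T (IsPermᵇ π)

ones : {n : ℕ} → Vec ℕ n → Vec Bool n → List ℕ
ones []       []          = []
ones (x ∷ xs) (true  ∷ b) = x ∷ ones xs b
ones (x ∷ xs) (false ∷ b) = ones xs b

zeros : {n : ℕ} → Vec ℕ n → Vec Bool n → List ℕ
zeros []       []          = []
zeros (x ∷ xs) (true  ∷ b) = zeros xs b
zeros (x ∷ xs) (false ∷ b) = x ∷ zeros xs b

mtdrl : {n : ℕ} → Vec ℕ n → Vec Bool n → List ℕ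
mtdrl π b = ones π b ++ reverse (zeros π b)

patterns : (n : ℕ) → List (Vec Bool n)
patterns zero    = [] ∷ []
patterns (suc n) = map (true ∷_) (patterns n) Data.List.++ map (false ∷_) (patterns n)

eqListᵇ : List ℕ → List ℕ → Bool
eqListᵇ []       []       = true
eqListᵇ (x ∷ xs) (y ∷ ys) = (x ≡ᵇ y) ∧ eqListᵇ xs ys
eqListᵇ _        _        = false

anyᵇ : {A : Set} → (A → Bool) → List A → Bool
anyᵇ p []       = false
anyᵇ p (x ∷ xs) = p x ∨ anyᵇ p xs

inOutᵇ : {n : ℕ} → Vec ℕ n → Vec ℕ n → Bool
inOutᵇ {n} π ρ = anyᵇ (λ b → eqListᵇ (mtdrl π b) (toList ρ)) (patterns n)

SOut : {n : ℕ} → Vec ℕ n → Set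
SOut {n} π = Σ[ ρ ∈ Vec ℕ n ] T (inOutᵇ π ρ)

SIn : {n : ℕ} → Vec ℕ n → Set
SIn {n} π = Σ[ ρ ∈ Vec ℕ n ] T (IsPermᵇ ρ ∧ inOutᵇ ρ π)

HasCard : Set → ℕ → Set
HasCard A k = Fin k ⤖ A

module Submission where

-- Let π have length n+1.  The bit that a pattern b assigns to the last
-- entry of π is irrelevant: that entry lands at the seam between the increasing and the
-- decreasing half either way.  Forgetting it leaves the reduced operation
-- rmtdrl π c (c ∈ {0,1}^n), defined by recursion on π: under a 1 the first entry
-- stays in front of the (recursively arranged) rest, under a 0 it goes behind it.
--   * S_out(π) is the image of c ↦ rmtdrl π c, and this map is injective when π has
--     distinct entries, because a 1 puts π₁ first while a 0 puts it last.
--   * For fixed c, rmtdrl _ c has the explicit inverse unmtdrl _ c, and it merely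
--     permutes entries, so it preserves Π(n+1).  Hence S_in(π) is the image of the
--     injective map c ↦ unmtdrl π c.
-- So both sets are in bijection with {0,1}^n, which has 2^n elements.

open import Defs
open import Data.Nat using (ℕ; zero; suc; _∸_; _^_; _+_; _≡ᵇ_)
open import Data.Nat.Properties using (≡ᵇ⇒≡; ≡⇒≡ᵇ; +-identityʳ)
open import Data.Bool using (Bool; true; false; _∧_; _∨_; not; T)
open import Data.Bool.Properties using (T-∧; T-∨; T-irrelevant; ∨-assoc; ∨-comm; ∧-assoc; ∧-comm)
open import Data.Unit using (tt)
open import Data.Empty using (⊥-elim)
open import Data.Product using (Σ-syntax; _×_; _,_; proj₁; proj₂)
open import Data.Sum using (inj₁; inj₂; _⊎_; [_,_]′)
open import Data.Sum.Function.Propositional using (_⊎-↔_)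
open import Data.Vec using (Vec; []; _∷_; _∷ʳ_; toList; init; last; initLast)
open import Data.Vec.Properties using (toList-injective; cast-is-id; toList-∷ʳ; ∷-injectiveˡ; ∷-injectiveʳ; ∷ʳ-injectiveˡ; init-∷ʳ; last-∷ʳ)
open import Data.List using (List; []; _∷_; [_]; _++_; reverse; map)
open import Data.List.Properties using (++-assoc; unfold-reverse)
open import Data.List.Membership.Propositional using (_∈_)
open import Data.List.Membership.Propositional.Properties using (∈-map⁺; ∈-++⁺ˡ; ∈-++⁺ʳ)
open import Data.List.Relation.Unary.Any using (here; there)
open import Data.List.Relation.Binary.Permutation.Propositional as Permutation using (_↭_; ↭-refl; ↭-prep; ↭-reflexive; ↭-sym; ↭-trans)
open import Data.List.Relation.Binary.Permutation.Propositional.Properties using (∷↭∷ʳ)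
open import Data.Fin using (Fin; zero)
open import Data.Fin.Properties using (+↔⊎)
open import Function.Bundles using (_↔_; mk↔ₛ′; Equivalence)
open import Function.Definitions using (Injective)
open import Function.Properties.Inverse using (↔-refl; ↔-sym; ↔-trans; ↔⇒⤖)
open import Relation.Nullary using (¬_)
open import Relation.Binary.PropositionalEquality using (_≡_; _≢_; refl; sym; trans; cong; cong₂; subst; module ≡-Reasoning)

open Equivalence using (to; from)

eqListᵇ-sound : ∀ xs ys → T (eqListᵇ xs ys) → xs ≡ ys
eqListᵇ-sound []       []       _  = refl
eqListᵇ-sound []       (_ ∷ _)  ()
eqListᵇ-sound (_ ∷ _)  []       ()
eqListᵇ-sound (x ∷ xs) (y ∷ ys) eq =
  let x≡y , xs≡ys = to (T-∧ {x ≡ᵇ y}) eq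
  in cong₂ _∷_ (≡ᵇ⇒≡ x y x≡y) (eqListᵇ-sound xs ys xs≡ys)

eqListᵇ-refl : ∀ xs → T (eqListᵇ xs xs)
eqListᵇ-refl []       = tt
eqListᵇ-refl (x ∷ xs) = from (T-∧ {x ≡ᵇ x}) (≡⇒≡ᵇ x x refl , eqListᵇ-refl xs)

anyᵇ-sound : {A : Set} (p : A → Bool) (xs : List A) → T (anyᵇ p xs) → Σ[ x ∈ A ] T (p x)
anyᵇ-sound p (x ∷ xs) holds with to (T-∨ {p x}) holds
... | inj₁ px   = x , px
... | inj₂ rest = anyᵇ-sound p xs rest

anyᵇ-complete : {A : Set} (p : A → Bool) {x : A} {xs : List A} → x ∈ xs → T (p x) → T (anyᵇ p xs)
anyᵇ-complete p {xs = y ∷ _} (here refl)  px = from (T-∨ {p y}) (inj₁ px)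
anyᵇ-complete p {xs = y ∷ _} (there x∈xs) px = from (T-∨ {p y}) (inj₂ (anyᵇ-complete p x∈xs px))

patterns-complete : ∀ {n} (b : Vec Bool n) → b ∈ patterns n
patterns-complete []                = here refl
patterns-complete {suc n} (true ∷ b)  = ∈-++⁺ˡ (∈-map⁺ (true ∷_) (patterns-complete b))
patterns-complete {suc n} (false ∷ b) =
  ∈-++⁺ʳ (map (true ∷_) (patterns n)) (∈-map⁺ (false ∷_) (patterns-complete b))

inOutᵇ-sound : ∀ {n} (π ρ : Vec ℕ n) → T (inOutᵇ π ρ) → Σ[ b ∈ Vec Bool n ] mtdrl π b ≡ toList ρ
inOutᵇ-sound {n} π ρ member =
  let b , eq = anyᵇ-sound (λ b → eqListᵇ (mtdrl π b) (toList ρ)) (patterns n) member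
  in b , eqListᵇ-sound _ _ eq

inOutᵇ-complete : ∀ {n} (π ρ : Vec ℕ n) (b : Vec Bool n) → mtdrl π b ≡ toList ρ → T (inOutᵇ π ρ)
inOutᵇ-complete π ρ b eq =
  anyᵇ-complete (λ b′ → eqListᵇ (mtdrl π b′) (toList ρ)) (patterns-complete b)
    (subst (λ l → T (eqListᵇ l (toList ρ))) (sym eq) (eqListᵇ-refl (toList ρ)))

rmtdrl : ∀ {A : Set} {n} → Vec A (suc n) → Vec Bool n → Vec A (suc n)
rmtdrl (x ∷ xs) (true  ∷ c) = x ∷ rmtdrl xs c
rmtdrl (x ∷ xs) (false ∷ c) = rmtdrl xs c ∷ʳ x
rmtdrl (x ∷ [])  []          = x ∷ []

mtdrl-rmtdrl : ∀ {n} (π : Vec ℕ (suc n)) (c : Vec Bool n) (t : Bool) →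
               mtdrl π (c ∷ʳ t) ≡ toList (rmtdrl π c)
mtdrl-rmtdrl (x ∷ [])  []          true  = refl
mtdrl-rmtdrl (x ∷ [])  []          false = refl
mtdrl-rmtdrl (x ∷ xs) (true  ∷ c) t     = cong (x ∷_) (mtdrl-rmtdrl xs c t)
mtdrl-rmtdrl (x ∷ xs) (false ∷ c) t     = begin
  ones xs b ++ reverse (x ∷ zeros xs b)        ≡⟨ cong (ones xs b ++_) (unfold-reverse x (zeros xs b)) ⟩
  ones xs b ++ (reverse (zeros xs b) ++ [ x ]) ≡⟨ ++-assoc (ones xs b) _ _ ⟨
  mtdrl xs b ++ [ x ]                          ≡⟨ cong (_++ [ x ]) (mtdrl-rmtdrl xs c t) ⟩
  toList (rmtdrl xs c) ++ [ x ]                ≡⟨ toList-∷ʳ x (rmtdrl xs c) ⟨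
  toList (rmtdrl xs c ∷ʳ x)                    ∎
  where
  open ≡-Reasoning
  b : Vec Bool _
  b = c ∷ʳ t

toList-cancel : ∀ {A : Set} {n} (u v : Vec A n) → toList u ≡ toList v → u ≡ v
toList-cancel u v eq = trans (sym (cast-is-id refl u)) (toList-injective refl u v eq)

inOutᵇ-rmtdrl : ∀ {n} (π : Vec ℕ (suc n)) (c : Vec Bool n) → T (inOutᵇ π (rmtdrl π c))
inOutᵇ-rmtdrl π c = inOutᵇ-complete π (rmtdrl π c) (c ∷ʳ true) (mtdrl-rmtdrl π c true)

inOutᵇ⇒rmtdrl : ∀ {n} (π ρ : Vec ℕ (suc n)) → T (inOutᵇ π ρ) → Σ[ c ∈ Vec Bool n ] rmtdrl π c ≡ ρ
inOutᵇ⇒rmtdrl π ρ member with inOutᵇ-sound π ρ member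
... | b , mtdrl≡ρ with initLast b
...   | c , t , refl = c , toList-cancel _ _ (trans (sym (mtdrl-rmtdrl π c t)) mtdrl≡ρ)

unmtdrl : ∀ {A : Set} {n} → Vec A (suc n) → Vec Bool n → Vec A (suc n)
unmtdrl π        []          = π
unmtdrl π        (false ∷ c) = last π ∷ unmtdrl (init π) c
unmtdrl (x ∷ π) (true  ∷ c) = x ∷ unmtdrl π c

unmtdrl-rmtdrl : ∀ {A : Set} {n} (ρ : Vec A (suc n)) (c : Vec Bool n) → unmtdrl (rmtdrl ρ c) c ≡ ρ
unmtdrl-rmtdrl (x ∷ [])  []          = refl
unmtdrl-rmtdrl (x ∷ xs) (true  ∷ c) = cong (x ∷_) (unmtdrl-rmtdrl xs c)
unmtdrl-rmtdrl (x ∷ xs) (false ∷ c) =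
  cong₂ _∷_ (last-∷ʳ x (rmtdrl xs c))
            (trans (cong (λ v → unmtdrl v c) (init-∷ʳ x (rmtdrl xs c))) (unmtdrl-rmtdrl xs c))

rmtdrl-unmtdrl : ∀ {A : Set} {n} (π : Vec A (suc n)) (c : Vec Bool n) → rmtdrl (unmtdrl π c) c ≡ π
rmtdrl-unmtdrl (x ∷ [])  []          = refl
rmtdrl-unmtdrl (x ∷ π)  (true  ∷ c) = cong (x ∷_) (rmtdrl-unmtdrl π c)
rmtdrl-unmtdrl π         (false ∷ c) =
  trans (cong (_∷ʳ last π) (rmtdrl-unmtdrl (init π) c)) (sym (proj₂ (proj₂ (initLast π))))

rmtdrl-↭ : ∀ {A : Set} {n} (v : Vec A (suc n)) (c : Vec Bool n) → toList (rmtdrl v c) ↭ toList v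
rmtdrl-↭ (x ∷ [])  []          = ↭-refl
rmtdrl-↭ (x ∷ xs) (true  ∷ c) = ↭-prep x (rmtdrl-↭ xs c)
rmtdrl-↭ (x ∷ xs) (false ∷ c) =
  ↭-trans (↭-reflexive (toList-∷ʳ x (rmtdrl xs c)))
    (↭-trans (↭-sym (∷↭∷ʳ x (toList (rmtdrl xs c)))) (↭-prep x (rmtdrl-↭ xs c)))

unmtdrl-↭ : ∀ {A : Set} {n} (π : Vec A (suc n)) (c : Vec Bool n) → toList (unmtdrl π c) ↭ toList π
unmtdrl-↭ π c =
  ↭-sym (subst (λ v → toList v ↭ toList (unmtdrl π c)) (rmtdrl-unmtdrl π c) (rmtdrl-↭ (unmtdrl π c) c))

∨-leftComm : ∀ a b c → a ∨ (b ∨ c) ≡ b ∨ (a ∨ c)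
∨-leftComm a b c = trans (sym (∨-assoc a b c)) (trans (cong (_∨ c) (∨-comm a b)) (∨-assoc b a c))

∧-leftComm : ∀ a b c → a ∧ (b ∧ c) ≡ b ∧ (a ∧ c)
∧-leftComm a b c = trans (sym (∧-assoc a b c)) (trans (cong (_∧ c) (∧-comm a b)) (∧-assoc b a c))

≡ᵇ-sym : ∀ m n → (m ≡ᵇ n) ≡ (n ≡ᵇ m)
≡ᵇ-sym zero    zero    = refl
≡ᵇ-sym zero    (suc n) = refl
≡ᵇ-sym (suc m) zero    = refl
≡ᵇ-sym (suc m) (suc n) = ≡ᵇ-sym m n

elemᵇ-↭ : ∀ y {xs ys} → xs ↭ ys → elemᵇ y xs ≡ elemᵇ y ys
elemᵇ-↭ y Permutation.refl          = refl
elemᵇ-↭ y (Permutation.prep x p)    = cong ((y ≡ᵇ x) ∨_) (elemᵇ-↭ y p)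
elemᵇ-↭ y (Permutation.swap a b p)  =
  trans (cong (λ e → (y ≡ᵇ a) ∨ ((y ≡ᵇ b) ∨ e)) (elemᵇ-↭ y p))
        (∨-leftComm (y ≡ᵇ a) (y ≡ᵇ b) _)
elemᵇ-↭ y (Permutation.trans p q)   = trans (elemᵇ-↭ y p) (elemᵇ-↭ y q)

allInᵇ-↭ : ∀ zs {xs ys} → xs ↭ ys → allInᵇ xs zs ≡ allInᵇ ys zs
allInᵇ-↭ zs Permutation.refl         = refl
allInᵇ-↭ zs (Permutation.prep x p)   = cong (elemᵇ x zs ∧_) (allInᵇ-↭ zs p)
allInᵇ-↭ zs (Permutation.swap a b p) =
  trans (cong (λ e → elemᵇ a zs ∧ (elemᵇ b zs ∧ e)) (allInᵇ-↭ zs p))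
        (∧-leftComm (elemᵇ a zs) (elemᵇ b zs) _)
allInᵇ-↭ zs (Permutation.trans p q)  = trans (allInᵇ-↭ zs p) (allInᵇ-↭ zs q)

-- Distinctness of x ∷ y ∷ l, written out, is symmetric in x and y (a Boolean identity).
distinct-swap : ∀ p q r s → not (p ∨ q) ∧ (not r ∧ s) ≡ not (p ∨ r) ∧ (not q ∧ s)
distinct-swap true  q     r     s = refl
distinct-swap false true  true  s = refl
distinct-swap false true  false s = refl
distinct-swap false false true  s = refl
distinct-swap false false false s = refl

distinctᵇ-↭ : ∀ {xs ys} → xs ↭ ys → distinctᵇ xs ≡ distinctᵇ ys
distinctᵇ-↭ Permutation.refl       = refl
distinctᵇ-↭ (Permutation.prep x p) = cong₂ (λ e d → not e ∧ d) (elemᵇ-↭ x p) (distinctᵇ-↭ p)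
distinctᵇ-↭ {x ∷ y ∷ xs} {_ ∷ _ ∷ ys} (Permutation.swap _ _ p) = begin
  shape (x ≡ᵇ y) (elemᵇ x xs) (elemᵇ y xs) (distinctᵇ xs)
    ≡⟨ distinct-swap (x ≡ᵇ y) (elemᵇ x xs) (elemᵇ y xs) (distinctᵇ xs) ⟩
  shape (x ≡ᵇ y) (elemᵇ y xs) (elemᵇ x xs) (distinctᵇ xs)
    ≡⟨ cong (λ e → shape e (elemᵇ y xs) (elemᵇ x xs) (distinctᵇ xs)) (≡ᵇ-sym x y) ⟩
  shape (y ≡ᵇ x) (elemᵇ y xs) (elemᵇ x xs) (distinctᵇ xs)
    ≡⟨ cong (λ e → shape (y ≡ᵇ x) e (elemᵇ x xs) (distinctᵇ xs)) (elemᵇ-↭ y p) ⟩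
  shape (y ≡ᵇ x) (elemᵇ y ys) (elemᵇ x xs) (distinctᵇ xs)
    ≡⟨ cong₂ (shape (y ≡ᵇ x) (elemᵇ y ys)) (elemᵇ-↭ x p) (distinctᵇ-↭ p) ⟩
  shape (y ≡ᵇ x) (elemᵇ y ys) (elemᵇ x ys) (distinctᵇ ys) ∎
  where
  open ≡-Reasoning
  shape : Bool → Bool → Bool → Bool → Bool
  shape e f g h = not (e ∨ f) ∧ (not g ∧ h)
distinctᵇ-↭ (Permutation.trans p q) = trans (distinctᵇ-↭ p) (distinctᵇ-↭ q)

IsPermᵇ-↭ : ∀ {n} (u v : Vec ℕ n) → toList u ↭ toList v → IsPermᵇ u ≡ IsPermᵇ v
IsPermᵇ-↭ u v u↭v = cong₂ _∧_ (distinctᵇ-↭ u↭v) (allInᵇ-↭ _ u↭v)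

head-fresh : ∀ x xs → T (distinctᵇ (x ∷ xs)) → ¬ T (elemᵇ x xs)
head-fresh x xs distinct x∈xs with elemᵇ x xs
... | true  = distinct
... | false = x∈xs

∷≡∷ʳ⇒elem : ∀ {n} x (u v : Vec ℕ (suc n)) → x ∷ u ≡ v ∷ʳ x → T (elemᵇ x (toList v))
∷≡∷ʳ⇒elem x u (y ∷ v) eq = from (T-∨ {x ≡ᵇ y}) (inj₁ (≡⇒≡ᵇ x y (∷-injectiveˡ eq)))

front≢back : ∀ {n} x (xs : Vec ℕ (suc n)) → T (distinctᵇ (x ∷ toList xs)) →
             ∀ u c → x ∷ u ≢ rmtdrl xs c ∷ʳ x
front≢back x xs distinct u c eq =
  head-fresh x (toList xs) distinct
    (subst T (elemᵇ-↭ x (rmtdrl-↭ xs c)) (∷≡∷ʳ⇒elem x u (rmtdrl xs c) eq))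

distinct-tail : ∀ x xs → T (distinctᵇ (x ∷ xs)) → T (distinctᵇ xs)
distinct-tail x xs distinct = proj₂ (to (T-∧ {not (elemᵇ x xs)}) distinct)

-- For π with distinct entries, different bit strings give different outcomes: the
-- first differing bit decides whether the current first entry ends up first or last.
rmtdrl-injective : ∀ {n} (π : Vec ℕ (suc n)) → T (distinctᵇ (toList π)) →
                   Injective _≡_ _≡_ (rmtdrl π)
rmtdrl-injective (x ∷ [])  distinct {[]}        {[]}         eq = refl
rmtdrl-injective (x ∷ xs) distinct {true  ∷ c} {true  ∷ c′} eq =
  cong (true ∷_) (rmtdrl-injective xs (distinct-tail x (toList xs) distinct) (∷-injectiveʳ eq))
rmtdrl-injective (x ∷ xs) distinct {false ∷ c} {false ∷ c′} eq =
  cong (false ∷_) (rmtdrl-injective xs (distinct-tail x (toList xs) distinct) (∷ʳ-injectiveˡ _ _ eq))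
rmtdrl-injective (x ∷ xs) distinct {true  ∷ c} {false ∷ c′} eq =
  ⊥-elim (front≢back x xs distinct _ c′ eq)
rmtdrl-injective (x ∷ xs) distinct {false ∷ c} {true  ∷ c′} eq =
  ⊥-elim (front≢back x xs distinct _ c (sym eq))

-- Since unmtdrl π c is a rearrangement of π, it inherits distinctness, and the
-- injectivity of rmtdrl transfers to unmtdrl π.
unmtdrl-injective : ∀ {n} (π : Vec ℕ (suc n)) → T (distinctᵇ (toList π)) →
                    Injective _≡_ _≡_ (unmtdrl π)
unmtdrl-injective π distinct {c} {c′} eq = rmtdrl-injective (unmtdrl π c) distinct′ (begin
  rmtdrl (unmtdrl π c) c    ≡⟨ rmtdrl-unmtdrl π c ⟩
  π                         ≡⟨ rmtdrl-unmtdrl π c′ ⟨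
  rmtdrl (unmtdrl π c′) c′  ≡⟨ cong (λ ρ → rmtdrl ρ c′) eq ⟨
  rmtdrl (unmtdrl π c) c′   ∎)
  where
  open ≡-Reasoning
  distinct′ : T (distinctᵇ (toList (unmtdrl π c)))
  distinct′ = subst T (sym (distinctᵇ-↭ (unmtdrl-↭ π c))) distinct

image↔ : {A B : Set} (P : A → Bool) (f : B → A) → Injective _≡_ _≡_ f →
         (∀ b → T (P (f b))) → (∀ a → T (P a) → Σ[ b ∈ B ] f b ≡ a) →
         B ↔ (Σ[ a ∈ A ] T (P a))
image↔ P f f-injective f-into f-onto =
  mk↔ₛ′ (λ b → f b , f-into b) (λ (a , p) → proj₁ (f-onto a p)) to∘from from∘to
  where
  subset-≡ : ∀ {a a′} (p : T (P a)) (p′ : T (P a′)) → a ≡ a′ → (a , p) ≡ (a′ , p′)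
  subset-≡ p p′ refl = cong (_ ,_) (T-irrelevant p p′)
  to∘from : ∀ ((a , p) : Σ[ a ∈ _ ] T (P a)) → (f (proj₁ (f-onto a p)) , f-into _) ≡ (a , p)
  to∘from (a , p) = subset-≡ _ p (proj₂ (f-onto a p))
  from∘to : ∀ b → proj₁ (f-onto (f b) (f-into b)) ≡ b
  from∘to b = f-injective (proj₂ (f-onto (f b) (f-into b)))

-- {0,1}^n has 2^n elements: split off the first bit and use Fin (m + k) ≅ Fin m ⊎ Fin k.
bits↔ : ∀ n → Vec Bool n ↔ Fin (2 ^ n)
bits↔ zero    = mk↔ₛ′ (λ _ → zero) (λ _ → []) (λ { zero → refl }) (λ { [] → refl })
bits↔ (suc n) = ↔-trans first-bit (↔-trans (bits↔ n ⊎-↔ ↔-trans (bits↔ n) pad) (↔-sym +↔⊎))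
  where
  first-bit : Vec Bool (suc n) ↔ (Vec Bool n ⊎ Vec Bool n)
  first-bit = mk↔ₛ′ (λ { (true ∷ c) → inj₁ c ; (false ∷ c) → inj₂ c }) [ true ∷_ , false ∷_ ]′
    (λ { (inj₁ _) → refl ; (inj₂ _) → refl }) (λ { (true ∷ _) → refl ; (false ∷ _) → refl })
  pad : Fin (2 ^ n) ↔ Fin (2 ^ n + 0)
  pad = subst (λ m → Fin (2 ^ n) ↔ Fin m) (sym (+-identityʳ (2 ^ n))) ↔-refl

card-via-bits : ∀ {n} {A : Set} → Vec Bool n ↔ A → HasCard A (2 ^ n)
card-via-bits {n} bits↔A = ↔⇒⤖ (↔-trans (↔-sym (bits↔ n)) bits↔A)

module _ {n : ℕ} (π : Vec ℕ (suc n)) (π-perm : T (IsPermᵇ π)) where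

  private
    π-distinct : T (distinctᵇ (toList π))
    π-distinct = proj₁ (to (T-∧ {distinctᵇ (toList π)}) π-perm)

  out↔ : Vec Bool n ↔ SOut π
  out↔ = image↔ (inOutᵇ π) (rmtdrl π)
    (rmtdrl-injective π π-distinct) (inOutᵇ-rmtdrl π) (inOutᵇ⇒rmtdrl π)

  in↔ : Vec Bool n ↔ SIn π
  in↔ = image↔ (λ ρ → IsPermᵇ ρ ∧ inOutᵇ ρ π) (unmtdrl π)
    (unmtdrl-injective π π-distinct) into onto
    where
    into : ∀ c → T (IsPermᵇ (unmtdrl π c) ∧ inOutᵇ (unmtdrl π c) π)
    into c = from (T-∧ {IsPermᵇ (unmtdrl π c)})
      ( subst T (sym (IsPermᵇ-↭ (unmtdrl π c) π (unmtdrl-↭ π c))) π-perm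
      , subst (λ σ → T (inOutᵇ (unmtdrl π c) σ)) (rmtdrl-unmtdrl π c) (inOutᵇ-rmtdrl (unmtdrl π c) c) )
    onto : ∀ ρ → T (IsPermᵇ ρ ∧ inOutᵇ ρ π) → Σ[ c ∈ Vec Bool n ] unmtdrl π c ≡ ρ
    onto ρ member with inOutᵇ⇒rmtdrl ρ π (proj₂ (to (T-∧ {IsPermᵇ ρ}) member))
    ... | c , refl = c , unmtdrl-rmtdrl ρ c

theorem6 : (n : ℕ) → (π : Perm (suc n)) →
    HasCard (SOut (proj₁ π)) (2 ^ (suc n ∸ 1)) × HasCard (SIn (proj₁ π)) (2 ^ (suc n ∸ 1))
theorem6 n (π , π-perm) = card-via-bits (out↔ π π-perm) , card-via-bits (in↔ π π-perm)
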